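{- Let $G$ be a finite simple graph. Then $m(G) \le 2^{\beta(G)}$, where $m(G)$ is the number of maximal independent sets of $G$ and $\beta(G)$ is the covering number of $G$.
   Context: For a finite simple graph $G$, $m(G)$ denotes the number of maximal independent sets of $G$ (a graph with no edges, including the graph with no vertices, has $m(G)=1$). A vertex cover of $G$ is a set $C\subseteq V(G)$ such that every edge of $G$ has at least one endpoint in $C$; the covering number $\beta(G)$ is the minimum size of a vertex cover of $G$. -}

module Defs where

open import Data.Nat using (ℕ; zero; suc; _⊓_; _^_; _≤_)
open import Data.Bool using (Bool; true; false; _∧_; _∨_; not; T)
open import Data.Fin using (Fin)
open import Data.Vec using (Vec; []; _∷_; lookup; replicate)
open import Data.List using (List; []; _∷_; map; _++_; filter; length; foldr; allFin)
open import Data.Bool.ListAction as BL using ()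
open import Relation.Binary.PropositionalEquality using (_≡_)
open import Relation.Nullary.Decidable using (T?)

record Graph (n : ℕ) : Set where
  field
    adj   : Fin n → Fin n → Bool
    sym   : ∀ u v → adj u v ≡ adj v u
    irrefl : ∀ v → adj v v ≡ false
open Graph public

-- A subset of V(G) = Fin n, as its characteristic vector.
VSet : ℕ → Set
VSet n = Vec Bool n

_∈ᵇ_ : ∀ {n} → Fin n → VSet n → Bool
v ∈ᵇ S = lookup S v

allSubsets : (n : ℕ) → List (VSet n)
allSubsets zero = [] ∷ []
allSubsets (suc n) = map (true ∷_) (allSubsets n) ++ map (false ∷_) (allSubsets n)

allV : ∀ {n} → (Fin n → Bool) → Bool
allV {n} p = BL.all p (allFin n)

anyV : ∀ {n} → (Fin n → Bool) → Bool
anyV {n} p = BL.any p (allFin n)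

isIndependent : ∀ {n} → Graph n → VSet n → Bool
isIndependent G S =
  allV (λ u → allV (λ v → not (u ∈ᵇ S ∧ v ∈ᵇ S ∧ adj G u v)))

-- S is a maximal independent set: independent, and adding any vertex
-- outside S destroys independence (i.e. every vertex not in S has a
-- neighbour in S).
isMaximalIndependent : ∀ {n} → Graph n → VSet n → Bool
isMaximalIndependent G S =
  isIndependent G S ∧
  allV (λ v → v ∈ᵇ S ∨ anyV (λ u → u ∈ᵇ S ∧ adj G u v))

m : ∀ {n} → Graph n → ℕ
m {n} G = length (filter (λ S → T? (isMaximalIndependent G S)) (allSubsets n))

isVertexCover : ∀ {n} → Graph n → VSet n → Bool
isVertexCover G C =
  allV (λ u → allV (λ v → not (adj G u v) ∨ u ∈ᵇ C ∨ v ∈ᵇ C))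

size : ∀ {n} → VSet n → ℕ
size [] = 0
size (true ∷ S) = suc (size S)
size (false ∷ S) = size S

-- β(G): the minimum size of a vertex cover. The full vertex set is always
-- a cover of size n, so the minimum over covers is taken starting from n.
β : ∀ {n} → Graph n → ℕ
β {n} G = foldr _⊓_ n
  (map size (filter (λ C → T? (isVertexCover G C)) (allSubsets n)))

-- Fix a vertex cover C.  Its complement is independent, so every neighbour of a
-- vertex outside C lies in C; for a maximal independent set S such a vertex is
-- in S exactly when it has no neighbour in S ∩ C.  Hence S is determined by its
-- trace S ∩ C, and there are at most 2^|C| maximal independent sets.  Taking C
-- of minimum size gives the bound.
module Submission where

open import Defs hiding (sym)
open import Data.Bool using (Bool; true; false; not; _∧_; _∨_; T; T?)
open import Data.Bool.Properties using (T-≡; T-∧; T-∨; T-not-≡; ⇔→≡)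
open import Data.Fin using (Fin)
open import Data.Fin.Subset using (_∩_; ⊤)
open import Data.List using (List; []; _∷_; _++_; map; filter; length; allFin)
open import Data.List.Properties using (filter-++; length-++; length-filter)
open import Data.List.Membership.Propositional.Properties
  using (∈-allFin; ∈-map⁻; ∈-filter⁻; foldr-selective)
open import Data.List.Relation.Unary.All as All using ()
open import Data.List.Relation.Unary.All.Properties using (all⁺; all⁻)
open import Data.List.Relation.Unary.Any using (satisfied)
open import Data.List.Relation.Unary.Any.Properties using (any⁻)
open import Data.Nat using (ℕ; zero; suc; _+_; _≤_; _^_)
open import Data.Nat.Properties using (⊓-sel; +-identityʳ; +-suc; +-mono-≤; module ≤-Reasoning)
open import Data.Empty using (⊥; ⊥-elim)
open import Data.Product using (∃-syntax; _×_; _,_; proj₁; proj₂)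
open import Data.Sum using (_⊎_; inj₁; inj₂)
open import Data.Vec using ([]; _∷_; lookup; tabulate)
open import Data.Vec.Properties
  using (∷-injectiveʳ; lookup-zipWith; lookup-replicate; tabulate-cong; tabulate∘lookup)
open import Function using (_∘_; _⇔_; mk⇔; Equivalence)
open import Level using (Level)
open import Relation.Binary.PropositionalEquality
open import Relation.Nullary using (¬_; yes; no; contradiction)
open import Relation.Nullary.Decidable using (_⊎-dec_; decidable-stable)
open import Relation.Unary using (Pred; Decidable)

open Equivalence using (to; from)

private
  variable
    a ℓ ℓ′ : Level
    A : Set a
    n : ℕ

count : {P : Pred A ℓ} → Decidable P → List A → ℕ
count P? xs = length (filter P? xs)

module _ {P : Pred A ℓ} (P? : Decidable P) where

  count-++ : ∀ xs ys → count P? (xs ++ ys) ≡ count P? xs + count P? ys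
  count-++ xs ys = trans (cong length (filter-++ P? xs ys)) (length-++ (filter P? xs))

  count-map : ∀ {B : Set a} (f : B → A) xs → count P? (map f xs) ≡ count (P? ∘ f) xs
  count-map f [] = refl
  count-map f (x ∷ xs) with P? (f x)
  ... | yes _ = cong suc (count-map f xs)
  ... | no _  = count-map f xs

  count-⊎-disjoint : {Q : Pred A ℓ′} (Q? : Decidable Q) → (∀ {x} → P x → Q x → ⊥) →
                     ∀ xs → count P? xs + count Q? xs ≡ count (λ x → P? x ⊎-dec Q? x) xs
  count-⊎-disjoint Q? P⊥Q [] = refl
  count-⊎-disjoint Q? P⊥Q (x ∷ xs) with P? x | Q? x
  ... | yes p | yes q = ⊥-elim (P⊥Q p q)
  ... | yes _ | no _  = cong suc (count-⊎-disjoint Q? P⊥Q xs)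
  ... | no _  | yes _ =
    trans (+-suc (count P? xs) (count Q? xs)) (cong suc (count-⊎-disjoint Q? P⊥Q xs))
  ... | no _  | no _  = count-⊎-disjoint Q? P⊥Q xs

DeterminedByTrace : VSet n → Pred (VSet n) ℓ → Set ℓ
DeterminedByTrace C P = ∀ {S S′} → P S → P S′ → C ∩ S ≡ C ∩ S′ → S ≡ S′

module _ {c : Bool} {C : VSet n} {P : Pred (VSet (suc n)) ℓ}
         (det : DeterminedByTrace (c ∷ C) P) where

  determinedByTrace-tail : ∀ b → DeterminedByTrace C (P ∘ (b ∷_))
  determinedByTrace-tail b p p′ eq = ∷-injectiveʳ (det p p′ (cong (c ∧ b ∷_) eq))

some-head : (P : Pred (VSet (suc n)) ℓ) {S : VSet n} →
            P (true ∷ S) ⊎ P (false ∷ S) → ∃[ b ] P (b ∷ S)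
some-head P (inj₁ p) = true , p
some-head P (inj₂ p) = false , p

module _ {C : VSet n} {P : Pred (VSet (suc n)) ℓ} (det : DeterminedByTrace (false ∷ C) P) where

  determinedByTrace-outside-disjoint : ∀ {S} → P (true ∷ S) → P (false ∷ S) → ⊥
  determinedByTrace-outside-disjoint p p′ with det p p′ refl
  ... | ()

  determinedByTrace-outside-tail : DeterminedByTrace C (λ S → P (true ∷ S) ⊎ P (false ∷ S))
  determinedByTrace-outside-tail p p′ eq with some-head P p | some-head P p′
  ... | _ , q | _ , q′ = ∷-injectiveʳ (det q q′ (cong (false ∷_) eq))

count-allSubsets-suc : {P : Pred (VSet (suc n)) ℓ} (P? : Decidable P) →
                       count P? (allSubsets (suc n)) ≡
                       count (P? ∘ (true ∷_)) (allSubsets n) + count (P? ∘ (false ∷_)) (allSubsets n)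
count-allSubsets-suc {n} P? = begin
  count P? (map (true ∷_) (allSubsets n) ++ map (false ∷_) (allSubsets n))
    ≡⟨ count-++ P? (map (true ∷_) (allSubsets n)) (map (false ∷_) (allSubsets n)) ⟩
  count P? (map (true ∷_) (allSubsets n)) + count P? (map (false ∷_) (allSubsets n))
    ≡⟨ cong₂ _+_ (count-map P? (true ∷_) (allSubsets n))
                 (count-map P? (false ∷_) (allSubsets n)) ⟩
  count (P? ∘ (true ∷_)) (allSubsets n) + count (P? ∘ (false ∷_)) (allSubsets n) ∎
  where open ≡-Reasoning

count-determinedByTrace : (C : VSet n) {P : Pred (VSet n) ℓ} (P? : Decidable P) →
                          DeterminedByTrace C P → count P? (allSubsets n) ≤ 2 ^ size C
count-determinedByTrace [] P? det = length-filter P? ([] ∷ [])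
count-determinedByTrace {suc n} (true ∷ C) P? det = begin
  count P? (allSubsets (suc n))
    ≡⟨ count-allSubsets-suc P? ⟩
  count (P? ∘ (true ∷_)) (allSubsets n) + count (P? ∘ (false ∷_)) (allSubsets n)
    ≤⟨ +-mono-≤ (count-determinedByTrace C _ (determinedByTrace-tail det true))
                (count-determinedByTrace C _ (determinedByTrace-tail det false)) ⟩
  2 ^ size C + 2 ^ size C
    ≡⟨ cong (2 ^ size C +_) (+-identityʳ (2 ^ size C)) ⟨
  2 ^ size (true ∷ C) ∎
  where open ≤-Reasoning
-- The first vertex lies outside C and so is invisible in the trace: P cannot hold both
-- with and without it, and the two halves of the count merge into one.
count-determinedByTrace {suc n} (false ∷ C) P? det = begin
  count P? (allSubsets (suc n))
    ≡⟨ count-allSubsets-suc P? ⟩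
  count (P? ∘ (true ∷_)) (allSubsets n) + count (P? ∘ (false ∷_)) (allSubsets n)
    ≡⟨ count-⊎-disjoint (P? ∘ (true ∷_)) (P? ∘ (false ∷_))
         (determinedByTrace-outside-disjoint det) (allSubsets n) ⟩
  count (λ S → P? (true ∷ S) ⊎-dec P? (false ∷ S)) (allSubsets n)
    ≤⟨ count-determinedByTrace C _ (determinedByTrace-outside-tail det) ⟩
  2 ^ size C ∎
  where open ≤-Reasoning

allV⁻ : {p : Fin n → Bool} → T (allV p) → ∀ v → T (p v)
allV⁻ {n} {p} h v = All.lookup (all⁺ p (allFin n) h) (∈-allFin v)

allV⁺ : {p : Fin n → Bool} → (∀ v → T (p v)) → T (allV p)
allV⁺ {n} {p} h = all⁻ p {allFin n} (All.tabulate (λ {v} _ → h v))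

anyV⁻ : {p : Fin n → Bool} → T (anyV p) → ∃[ v ] T (p v)
anyV⁻ {n} {p} h = satisfied (any⁻ p (allFin n) h)

∈ᵇ-∩ : ∀ (C S : VSet n) v → T (v ∈ᵇ (C ∩ S)) ⇔ (T (v ∈ᵇ C) × T (v ∈ᵇ S))
∈ᵇ-∩ C S v rewrite lookup-zipWith _∧_ v C S = T-∧

∈ᵇ-∩-inside : ∀ (C S : VSet n) {v} → T (v ∈ᵇ C) → v ∈ᵇ (C ∩ S) ≡ v ∈ᵇ S
∈ᵇ-∩-inside C S {v} v∈C =
  trans (lookup-zipWith _∧_ v C S) (cong (_∧ v ∈ᵇ S) (to T-≡ v∈C))

module _ (G : Graph n) where

  independent⇒¬adj : ∀ S {u v} → T (isIndependent G S) →
                     T (u ∈ᵇ S) → T (v ∈ᵇ S) → ¬ T (adj G u v)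
  independent⇒¬adj S {u} {v} ind u∈S v∈S uv =
    subst T (to T-not-≡ (allV⁻ (allV⁻ ind u) v)) (from T-∧ (u∈S , from T-∧ (v∈S , uv)))

  maximal⇒dominated : ∀ S {v} → T (isMaximalIndependent G S) →
                      ¬ T (v ∈ᵇ S) → ∃[ u ] T (u ∈ᵇ S) × T (adj G u v)
  maximal⇒dominated S {v} mis v∉S
    with to T-∨ (allV⁻ (proj₂ (to T-∧ mis)) v)
  ... | inj₁ v∈S = contradiction v∈S v∉S
  ... | inj₂ dom with anyV⁻ dom
  ...   | u , h = u , to T-∧ h

  cover⇒neighbour∈ : ∀ C {u v} → T (isVertexCover G C) → T (adj G u v) →
                     ¬ T (v ∈ᵇ C) → T (u ∈ᵇ C)
  cover⇒neighbour∈ C {u} {v} cov uv v∉C with to T-∨ (allV⁻ (allV⁻ cov u) v)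
  ... | inj₁ ¬uv = ⊥-elim (subst T (to T-not-≡ ¬uv) uv)
  ... | inj₂ h with to T-∨ h
  ...   | inj₁ u∈C = u∈C
  ...   | inj₂ v∈C = contradiction v∈C v∉C

  module _ {C : VSet n} (cov : T (isVertexCover G C)) where

    trace-outside-cover : ∀ {S S′ v} →
                          T (isMaximalIndependent G S) → T (isMaximalIndependent G S′) →
                          C ∩ S ≡ C ∩ S′ → ¬ T (v ∈ᵇ C) → T (v ∈ᵇ S) → T (v ∈ᵇ S′)
    trace-outside-cover {S} {S′} {v} mis mis′ eq v∉C v∈S =
      decidable-stable (T? (v ∈ᵇ S′)) λ v∉S′ →
        let u , u∈S′ , uv = maximal⇒dominated S′ mis′ v∉S′
            u∈C∩S′ = from (∈ᵇ-∩ C S′ u) (cover⇒neighbour∈ C cov uv v∉C , u∈S′)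
            u∈S = proj₂ (to (∈ᵇ-∩ C S u) (subst (λ X → T (u ∈ᵇ X)) (sym eq) u∈C∩S′))
        in independent⇒¬adj S (proj₁ (to T-∧ mis)) u∈S v∈S uv

    maximalIndependent-determinedByTrace : DeterminedByTrace C (T ∘ isMaximalIndependent G)
    maximalIndependent-determinedByTrace {S} {S′} mis mis′ eq = begin
      S                  ≡⟨ tabulate∘lookup S ⟨
      tabulate (lookup S)  ≡⟨ tabulate-cong same-at ⟩
      tabulate (lookup S′) ≡⟨ tabulate∘lookup S′ ⟩
      S′                 ∎
      where
      open ≡-Reasoning
      same-at : ∀ v → v ∈ᵇ S ≡ v ∈ᵇ S′
      same-at v with T? (v ∈ᵇ C)
      ... | yes v∈C = begin
        v ∈ᵇ S         ≡⟨ ∈ᵇ-∩-inside C S v∈C ⟨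
        v ∈ᵇ (C ∩ S)   ≡⟨ cong (v ∈ᵇ_) eq ⟩
        v ∈ᵇ (C ∩ S′)  ≡⟨ ∈ᵇ-∩-inside C S′ v∈C ⟩
        v ∈ᵇ S′        ∎
      ... | no v∉C = ⇔→≡ (mk⇔ (to T-≡ ∘ trace-outside-cover mis mis′ eq v∉C ∘ from T-≡)
                              (to T-≡ ∘ trace-outside-cover mis′ mis (sym eq) v∉C ∘ from T-≡))

size-⊤ : ∀ n → size (⊤ {n}) ≡ n
size-⊤ zero    = refl
size-⊤ (suc n) = cong suc (size-⊤ n)

⊤-isVertexCover : (G : Graph n) → T (isVertexCover G ⊤)
⊤-isVertexCover {n} G =
  allV⁺ {p = λ u → allV (covers u)} λ u → allV⁺ {p = covers u} (⊤-covers u)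
  where
  covers : Fin n → Fin n → Bool
  covers u v = not (adj G u v) ∨ u ∈ᵇ ⊤ ∨ v ∈ᵇ ⊤
  ⊤-covers : ∀ u v → T (covers u v)
  ⊤-covers u v = from (T-∨ {not (adj G u v)})
                   (inj₂ (from (T-∨ {u ∈ᵇ ⊤}) (inj₁ (from T-≡ (lookup-replicate u true)))))

β-attained : (G : Graph n) → ∃[ C ] T (isVertexCover G C) × β G ≡ size C
β-attained {n} G
  with foldr-selective ⊓-sel n (map size (filter (T? ∘ isVertexCover G) (allSubsets n)))
... | inj₁ β≡n = ⊤ , ⊤-isVertexCover G , trans β≡n (sym (size-⊤ n))
... | inj₂ β∈ with ∈-map⁻ size β∈
...   | C , C∈ , β≡ = C , proj₂ (∈-filter⁻ (T? ∘ isVertexCover G) {xs = allSubsets n} C∈) , β≡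

theorem2p7 : (n : ℕ) (G : Graph n) → m G ≤ 2 ^ β G
theorem2p7 n G with β-attained G
... | C , cov , β≡ = begin
  m G       ≤⟨ count-determinedByTrace C (T? ∘ isMaximalIndependent G)
                 (maximalIndependent-determinedByTrace G cov) ⟩
  2 ^ size C ≡⟨ cong (2 ^_) β≡ ⟨
  2 ^ β G   ∎
  where open ≤-Reasoning
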